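{- Let $k, r, n$ be integers with $3 \le k < r < n$ satisfying $$\chi(n-r+k-1,k-1) + n - r + k - 1 \le n \le \binom{n-r+k-1}{k-1} + n - r + k - 1.$$ Then there exists a primitive uniquely $K_r^{(k)}$-saturated $k$-uniform hypergraph on $n$ vertices.
   Context: The Johnson graph $J(m,j)$ has vertex set $\binom{[m]}{j}$, two $j$-sets being adjacent iff they intersect in exactly $j-1$ elements; $\chi(m,j)$ denotes the chromatic number of $J(m,j)$. $K_r^{(k)}$ denotes the complete $k$-uniform hypergraph on $r$ vertices. A $k$-uniform hypergraph $H$ is uniquely $K_r^{(k)}$-saturated if $H$ contains no copy of $K_r^{(k)}$ (i.e., no $r$-set of vertices all of whose $k$-subsets are edges), and for every $k$-subset $S$ of $V(H)$ that is not an edge of $H$, the hypergraph $H+S$ contains exactly one copy of $K_r^{(k)}$. A vertex $v$ is dominating in $H$ if every $k$-subset of $V(H)$ containing $v$ is an edge of $H$. $H$ is primitive uniquely $K_r^{(k)}$-saturated if it is uniquely $K_r^{(k)}$-saturated and has no dominating vertex. -}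

module Defs where

open import Data.Nat using (ℕ; _≤_; _∸_)
open import Data.Bool using (Bool; true)
open import Data.Fin using (Fin)
open import Data.Fin.Subset using (Subset; ∣_∣; _∩_; _⊆_; _∈_)
open import Data.Product using (Σ; _×_)
open import Data.Sum using (_⊎_)
open import Relation.Nullary using (¬_)
open import Relation.Binary.PropositionalEquality using (_≡_; _≢_)

JohnsonAdj : (m j : ℕ) → Subset m → Subset m → Set
JohnsonAdj m j A B = (∣ A ∣ ≡ j) × (∣ B ∣ ≡ j) × (∣ A ∩ B ∣ ≡ j ∸ 1)

JohnsonColorable : (m j c : ℕ) → Set
JohnsonColorable m j c =
  Σ ((A : Subset m) → ∣ A ∣ ≡ j → Fin c) λ f →
    (A B : Subset m) (adj : JohnsonAdj m j A B) →
      f A (Data.Product.proj₁ adj) ≢ f B (Data.Product.proj₁ (Data.Product.proj₂ adj))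

IsJohnsonChromaticNumber : (m j χ : ℕ) → Set
IsJohnsonChromaticNumber m j χ =
  JohnsonColorable m j χ × ((c : ℕ) → JohnsonColorable m j c → χ ≤ c)

Hypergraph : ℕ → Set
Hypergraph n = Subset n → Bool

IsEdge : ∀ {n} → Hypergraph n → Subset n → Set
IsEdge H S = H S ≡ true

IsUniform : ∀ {n} → ℕ → Hypergraph n → Set
IsUniform k H = ∀ S → IsEdge H S → ∣ S ∣ ≡ k

IsCliqueOn : ∀ {n} → (k r : ℕ) → (Subset n → Set) → Subset n → Set
IsCliqueOn k r E R = (∣ R ∣ ≡ r) × (∀ S → S ⊆ R → ∣ S ∣ ≡ k → E S)

AddEdge : ∀ {n} → Hypergraph n → Subset n → (Subset n → Set)
AddEdge H S T = IsEdge H T ⊎ T ≡ S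

IsUniquelySaturated : ∀ {n} → (k r : ℕ) → Hypergraph n → Set
IsUniquelySaturated {n} k r H =
  (¬ Σ (Subset n) (IsCliqueOn k r (IsEdge H))) ×
  (∀ S → ∣ S ∣ ≡ k → ¬ IsEdge H S →
     Σ (Subset n) λ R → IsCliqueOn k r (AddEdge H S) R ×
       (∀ R′ → IsCliqueOn k r (AddEdge H S) R′ → R′ ≡ R))

IsDominating : ∀ {n} → ℕ → Hypergraph n → Fin n → Set
IsDominating k H v = ∀ S → ∣ S ∣ ≡ k → v ∈ S → IsEdge H S

IsPrimitiveUniquelySaturated : ∀ {n} → (k r : ℕ) → Hypergraph n → Set
IsPrimitiveUniquelySaturated {n} k r H =
  IsUniquelySaturated k r H × ((v : Fin n) → ¬ IsDominating k H v)

module Submission where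

-- Put j = k - 1, i = j - 1, m = n - r + j and y = r - j, so that n = m + y and r = y + j.
-- Since χ(m,j) ≤ y ≤ C(m,j) there is a proper colouring c of J(m,j) with exactly y colours,
-- all of them used: an optimal colouring uses every colour, and while fewer than C(m,j)
-- colours are used two j-sets share one, so one of them can receive a fresh colour.
-- On the vertex set Fin (m + y) = Fin m ⊎ Fin y the hypergraph H consists of all k-sets
-- except the caps T ∪ {c T} with T a j-subset of Fin m.
-- Counting step: if an r-set A ∪ B (A ⊆ Fin m, B ⊆ Fin y) contains an i-set W ⊆ A but no cap
-- over W ∪ {x} for x ∈ A ∖ W, the colours c (W ∪ {x}) are distinct (these j-sets are
-- adjacent in J(m,j)) and avoid B, whence ∣A∣ + ∣B∣ ≤ y + i < r, impossible.
-- Hence H contains no K_r, and adding the cap over T creates exactly one K_r, on T ∪ Fin y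
-- (k ≥ 3 lets W contain a vertex outside T). Every vertex lies on a cap: none dominates.

open import Defs
open import Data.Nat using (ℕ; _≤_; _<_; _+_; _∸_)
open import Data.Nat.Combinatorics using (_C_)
open import Data.Product using (Σ; _×_)

module Enumeration where

  open import Data.Nat using (zero; suc; s<s⁻¹)
  open import Data.Nat.Combinatorics using (nCk+nC[k+1]≡[n+1]C[k+1])
  open import Data.Bool using (true; false)
  open import Data.Fin using (Fin; zero; suc)
  import Data.Fin as Fin
  import Data.Fin.Properties as Fin
  open import Data.Fin.Subset using (Subset; ∣_∣)
  open import Data.Vec using ([]; _∷_)
  import Data.Vec.Properties as Vec
  open import Data.List using (List; []; _∷_; [_]; map; _++_; length; lookup)
  open import Data.List.Properties using (length-map; length-++)
  open import Data.List.Relation.Unary.All as All using (All; []; _∷_)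
  import Data.List.Relation.Unary.All.Properties as All
  open import Data.List.Relation.Unary.Unique.Propositional using (Unique; []; _∷_)
  import Data.List.Relation.Unary.Unique.Propositional.Properties as Unique
  open import Data.List.Membership.Propositional using (_∈_)
  open import Data.List.Membership.Propositional.Properties using (∈-lookup; ∈-map⁻)
  open import Data.Product using (∃₂; _,_)
  open import Function using (_∘_)
  open import Relation.Nullary using (¬_)
  open import Relation.Binary.PropositionalEquality
    using (_≡_; _≢_; refl; sym; trans; cong; cong₂; subst; module ≡-Reasoning)

  subsets : (m j : ℕ) → List (Subset m)
  subsets zero    zero    = [ [] ]
  subsets zero    (suc j) = []
  subsets (suc m) zero    = map (false ∷_) (subsets m zero)
  subsets (suc m) (suc j) = map (true ∷_) (subsets m j) ++ map (false ∷_) (subsets m (suc j))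

  length-subsets : ∀ m j → length (subsets m j) ≡ m C j
  length-subsets zero    zero    = refl
  length-subsets zero    (suc j) = refl
  length-subsets (suc m) zero    = trans (length-map _ (subsets m zero)) (length-subsets m zero)
  length-subsets (suc m) (suc j) = begin
    length (map (true ∷_) (subsets m j) ++ map (false ∷_) (subsets m (suc j)))
      ≡⟨ length-++ (map (true ∷_) (subsets m j)) ⟩
    length (map (true ∷_) (subsets m j)) + length (map (false ∷_) (subsets m (suc j)))
      ≡⟨ cong₂ _+_ (length-map _ (subsets m j)) (length-map _ (subsets m (suc j))) ⟩
    length (subsets m j) + length (subsets m (suc j))
      ≡⟨ cong₂ _+_ (length-subsets m j) (length-subsets m (suc j)) ⟩
    m C j + m C suc j
      ≡⟨ nCk+nC[k+1]≡[n+1]C[k+1] m j ⟩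
    suc m C suc j ∎
    where open ≡-Reasoning

  subsets-size : ∀ m j → All (λ A → ∣ A ∣ ≡ j) (subsets m j)
  subsets-size zero    zero    = refl ∷ []
  subsets-size zero    (suc j) = []
  subsets-size (suc m) zero    = All.map⁺ (subsets-size m zero)
  subsets-size (suc m) (suc j) =
    All.++⁺ (All.map⁺ (All.map (cong suc) (subsets-size m j))) (All.map⁺ (subsets-size m (suc j)))

  subsets-unique : ∀ m j → Unique (subsets m j)
  subsets-unique zero    zero    = [] ∷ []
  subsets-unique zero    (suc j) = []
  subsets-unique (suc m) zero    = Unique.map⁺ Vec.∷-injectiveʳ (subsets-unique m zero)
  subsets-unique (suc m) (suc j) =
    Unique.++⁺ (Unique.map⁺ Vec.∷-injectiveʳ (subsets-unique m j))
               (Unique.map⁺ Vec.∷-injectiveʳ (subsets-unique m (suc j)))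
               heads-differ
    where
    heads-differ : ∀ {v} →
      ¬ (v ∈ map (true ∷_) (subsets m j) × v ∈ map (false ∷_) (subsets m (suc j)))
    heads-differ (v∈ₜ , v∈f) with ∈-map⁻ (true ∷_) v∈ₜ | ∈-map⁻ (false ∷_) v∈f
    ... | _ , _ , refl | _ , _ , ()

  unique-lookup : ∀ {A : Set} {xs : List A} → Unique xs →
    ∀ {i i′} → i Fin.< i′ → lookup xs i ≢ lookup xs i′
  unique-lookup (x≢xs ∷ _) {zero} {suc i′} _ = All.lookup x≢xs (∈-lookup i′)
  unique-lookup (_ ∷ xs-unique) {suc i} {suc i′} i<i′ = unique-lookup xs-unique (s<s⁻¹ i<i′)

  collision : ∀ {m j d} (g : Subset m → Fin d) → d < m C j →
    ∃₂ λ A B → ∣ A ∣ ≡ j × ∣ B ∣ ≡ j × A ≢ B × g A ≡ g B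
  collision {m} {j} g d<mCj
    with Fin.pigeonhole (subst (_ <_) (sym (length-subsets m j)) d<mCj) (g ∘ lookup (subsets m j))
  ... | i , i′ , i<i′ , g≡ =
    lookup (subsets m j) i , lookup (subsets m j) i′ ,
    All.lookup (subsets-size m j) (∈-lookup i) , All.lookup (subsets-size m j) (∈-lookup i′) ,
    unique-lookup (subsets-unique m j) i<i′ , g≡

open Enumeration using (collision)

open import Data.Nat using (zero; suc; z≤n; s≤s; s≤s⁻¹; _≤′_; ≤′-reflexive; ≤′-step; _≟_)
open import Data.Nat.Properties
  using (+-suc; +-comm; +-assoc; <-irrefl; ≤-trans; ≤⇒≤′; <⇒≤; n≤1+n; m≤n+m; ≡-irrelevant;
         +-cancelˡ-≤; +-cancelʳ-≤; +-cancelˡ-≡; +-monoˡ-≤; +-monoʳ-≤; m∸n+n≡m; m+[n∸m]≡n;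
         m≤n⇒m<n∨m≡n; module ≤-Reasoning; +-commutativeSemigroup)
open import Algebra.Properties.CommutativeSemigroup +-commutativeSemigroup using (xy∙z≈xz∙y)
open import Data.Bool using (true; false)
import Data.Bool as Bool
open import Data.Fin using (Fin; zero; suc; _↑ˡ_; _↑ʳ_; fromℕ; inject₁; punchOut)
import Data.Fin
import Data.Fin.Properties as Fin
import Data.Fin.Relation.Unary.Top as Top
open Top using (‵fromℕ; ‵inject₁)
open import Data.Fin.Subset
open import Data.Fin.Subset.Properties
open import Data.Vec using (_∷_; []; here; there; _++_; splitAt)
import Data.Vec.Properties as Vec
open import Data.Product using (∃; _,_; proj₁; proj₂)
open import Data.Sum using (_⊎_; inj₁; inj₂)
open import Data.Empty using (⊥-elim)
open import Function using (_∘_)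
open import Relation.Nullary using (¬_; Dec; yes; no; does; _×-dec_; ¬?; contradiction)
open import Relation.Nullary.Decidable using (map′; dec-true; decidable-stable)
open import Relation.Binary.PropositionalEquality

⊈⇒witness : ∀ {n} {p q : Subset n} → ¬ (p ⊆ q) → ∃ λ z → z ∈ p × z ∉ q
⊈⇒witness {p = p} {q} p⊈q with Fin.any? (λ z → (z ∈? p) ×-dec ¬? (z ∈? q))
... | yes witness = witness
... | no none = ⊥-elim (p⊈q p⊆q)
  where
  p⊆q : p ⊆ q
  p⊆q {z} z∈p with z ∈? q
  ... | yes z∈q = z∈q
  ... | no z∉q = ⊥-elim (none (z , z∈p , z∉q))

⊆∧∣≡∣⇒≡ : ∀ {n} {p q : Subset n} → p ⊆ q → ∣ p ∣ ≡ ∣ q ∣ → p ≡ q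
⊆∧∣≡∣⇒≡ {p = p} {q} p⊆q ∣p∣≡∣q∣ with q ⊆? p
... | yes q⊆p = ⊆-antisym p⊆q q⊆p
... | no q⊈p = contradiction ∣p∣≡∣q∣ (λ e → <-irrefl e (p⊂q⇒∣p∣<∣q∣ (p⊆q , ⊈⇒witness q⊈p)))

∣q∣<∣p∣⇒outside : ∀ {n} {p q : Subset n} → ∣ q ∣ < ∣ p ∣ → ∃ λ z → z ∈ p × z ∉ q
∣q∣<∣p∣⇒outside {p = p} {q} ∣q∣<∣p∣ with p ⊆? q
... | yes p⊆q = contradiction (≤-trans ∣q∣<∣p∣ (p⊆q⇒∣p∣≤∣q∣ p⊆q)) (<-irrefl refl)
... | no p⊈q = ⊈⇒witness p⊈q

x∈p─q⇒x∉q : ∀ {n} {p q : Subset n} {x} → x ∈ p ─ q → x ∉ q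
x∈p─q⇒x∉q {p = s ∷ p} {true ∷ q} {zero} ()
x∈p─q⇒x∉q {p = s ∷ p} {false ∷ q} {zero} _ ()
x∈p─q⇒x∉q {p = s ∷ p} {t ∷ q} {suc x} x∈p─q x∈q =
  x∈p─q⇒x∉q {p = p} (drop-there x∈p─q) (drop-there x∈q)

x∈p⇒⁅x⁆⊆p : ∀ {n} {p : Subset n} {x} → x ∈ p → ⁅ x ⁆ ⊆ p
x∈p⇒⁅x⁆⊆p {p = p} {x} x∈p z∈⁅x⁆ = subst (_∈ p) (sym (x∈⁅y⁆⇒x≡y x z∈⁅x⁆)) x∈p

∣p─q∣+∣q∣≡∣p∣ : ∀ {n} (p q : Subset n) → q ⊆ p → ∣ p ─ q ∣ + ∣ q ∣ ≡ ∣ p ∣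
∣p─q∣+∣q∣≡∣p∣ [] [] _ = refl
∣p─q∣+∣q∣≡∣p∣ (true ∷ p) (true ∷ q) q⊆p =
  trans (+-suc _ _) (cong suc (∣p─q∣+∣q∣≡∣p∣ p q (drop-∷-⊆ q⊆p)))
∣p─q∣+∣q∣≡∣p∣ (true ∷ p) (false ∷ q) q⊆p = cong suc (∣p─q∣+∣q∣≡∣p∣ p q (drop-∷-⊆ q⊆p))
∣p─q∣+∣q∣≡∣p∣ (false ∷ p) (false ∷ q) q⊆p = ∣p─q∣+∣q∣≡∣p∣ p q (drop-∷-⊆ q⊆p)
∣p─q∣+∣q∣≡∣p∣ (false ∷ p) (true ∷ q) q⊆p with q⊆p here
... | ()

∣p∪⁅x⁆∣≡1+∣p∣ : ∀ {n} (p : Subset n) x → x ∉ p → ∣ p ∪ ⁅ x ⁆ ∣ ≡ suc ∣ p ∣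
∣p∪⁅x⁆∣≡1+∣p∣ (true ∷ p) zero x∉p = contradiction here x∉p
∣p∪⁅x⁆∣≡1+∣p∣ (false ∷ p) zero x∉p = cong (suc ∘ ∣_∣) (∪-identityʳ p)
∣p∪⁅x⁆∣≡1+∣p∣ (true ∷ p) (suc x) x∉p = cong suc (∣p∪⁅x⁆∣≡1+∣p∣ p x (x∉p ∘ there))
∣p∪⁅x⁆∣≡1+∣p∣ (false ∷ p) (suc x) x∉p = ∣p∪⁅x⁆∣≡1+∣p∣ p x (x∉p ∘ there)

∪⁅⁆-⊆ : ∀ {n} {p q : Subset n} {x} → p ⊆ q → x ∈ q → p ∪ ⁅ x ⁆ ⊆ q
∪⁅⁆-⊆ {p = p} {q} {x} p⊆q x∈q {z} z∈p∪x with x∈p∪q⁻ p ⁅ x ⁆ z∈p∪x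
... | inj₁ z∈p = p⊆q z∈p
... | inj₂ z∈⁅x⁆ = x∈p⇒⁅x⁆⊆p x∈q z∈⁅x⁆

∪⁅⁆∩∪⁅⁆≡ : ∀ {n} (p : Subset n) {x x′} → x ≢ x′ → (p ∪ ⁅ x ⁆) ∩ (p ∪ ⁅ x′ ⁆) ≡ p
∪⁅⁆∩∪⁅⁆≡ p {x} {x′} x≢x′ = begin
  (p ∪ ⁅ x ⁆) ∩ (p ∪ ⁅ x′ ⁆) ≡⟨ ∪-distribˡ-∩ p ⁅ x ⁆ ⁅ x′ ⁆ ⟨
  p ∪ (⁅ x ⁆ ∩ ⁅ x′ ⁆)        ≡⟨ cong (p ∪_) (Empty-unique disjoint) ⟩
  p ∪ ⊥                        ≡⟨ ∪-identityʳ p ⟩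
  p                            ∎
  where
  open ≡-Reasoning
  disjoint : Empty (⁅ x ⁆ ∩ ⁅ x′ ⁆)
  disjoint (z , z∈both) with x∈p∩q⁻ ⁅ x ⁆ ⁅ x′ ⁆ z∈both
  ... | z∈⁅x⁆ , z∈⁅x′⁆ = x≢x′ (trans (sym (x∈⁅y⁆⇒x≡y x z∈⁅x⁆)) (x∈⁅y⁆⇒x≡y x′ z∈⁅x′⁆))

_≟ₛ_ : ∀ {m} (A B : Subset m) → Dec (A ≡ B)
_≟ₛ_ = Vec.≡-dec Bool._≟_

choose : ∀ {n} (p : Subset n) s → s ≤ ∣ p ∣ → Σ (Subset n) λ w → w ⊆ p × ∣ w ∣ ≡ s
choose {n} p zero _ = ⊥ , ⊥⊆ , ∣⊥∣≡0 n
choose (true ∷ p) (suc s) (s≤s s≤∣p∣) with choose p s s≤∣p∣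
... | w , w⊆p , ∣w∣≡s = true ∷ w , in⊆in w⊆p , cong suc ∣w∣≡s
choose (false ∷ p) (suc s) s<∣p∣ with choose p (suc s) s<∣p∣
... | w , w⊆p , ∣w∣≡s = false ∷ w , out⊆ w⊆p , ∣w∣≡s

choose∋ : ∀ {n} (p : Subset n) {z} s → z ∈ p → 1 ≤ s → s ≤ ∣ p ∣ →
  Σ (Subset n) λ w → w ⊆ p × ∣ w ∣ ≡ s × z ∈ w
choose∋ p {z} (suc s) z∈p _ s<∣p∣ with choose (p - z) s s≤∣p-z∣
  where
  ∣p-z∣+1≡∣p∣ : ∣ p - z ∣ + 1 ≡ ∣ p ∣
  ∣p-z∣+1≡∣p∣ = subst (λ t → ∣ p - z ∣ + t ≡ ∣ p ∣) (∣⁅x⁆∣≡1 z)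
    (∣p─q∣+∣q∣≡∣p∣ p ⁅ z ⁆ (x∈p⇒⁅x⁆⊆p z∈p))
  s≤∣p-z∣ : s ≤ ∣ p - z ∣
  s≤∣p-z∣ = s≤s⁻¹ (subst (suc s ≤_) (trans (sym ∣p-z∣+1≡∣p∣) (+-comm _ 1)) s<∣p∣)
... | w , w⊆p-z , ∣w∣≡s =
  w ∪ ⁅ z ⁆ , ∪⁅⁆-⊆ (p─q⊆p p ⁅ z ⁆ ∘ w⊆p-z) z∈p ,
  trans (∣p∪⁅x⁆∣≡1+∣p∣ w z z∉w) (cong suc ∣w∣≡s) , x∈p∪q⁺ (inj₂ (x∈⁅x⁆ z))
  where
  z∉w : z ∉ w
  z∉w z∈w = x∈p─q⇒x∉q {p = p} (w⊆p-z z∈w) (x∈⁅x⁆ z)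

injection⇒∣∣≤ : ∀ {m n} (d : Subset m) (e : Subset n) (g : Fin m → Fin n) →
  (∀ {x} → x ∈ d → g x ∈ e) → (∀ {x x′} → x ∈ d → x′ ∈ d → g x ≡ g x′ → x ≡ x′) →
  ∣ d ∣ ≤ ∣ e ∣
injection⇒∣∣≤ [] e g into inj = z≤n
injection⇒∣∣≤ (false ∷ d) e g into inj =
  injection⇒∣∣≤ d e (g ∘ suc) (into ∘ there)
    (λ x∈d x′∈d → Fin.suc-injective ∘ inj (there x∈d) (there x′∈d))
injection⇒∣∣≤ (true ∷ d) e g into inj = ≤-trans (s≤s rest) (x∈p⇒∣p-x∣<∣p∣ (into here))
  where
  rest : ∣ d ∣ ≤ ∣ e - g zero ∣
  rest = injection⇒∣∣≤ d (e - g zero) (g ∘ suc)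
    (λ x∈d → x∈p∧x≢y⇒x∈p-y (into (there x∈d)) (λ eq → Fin.0≢1+n (sym (inj (there x∈d) here eq))))
    (λ x∈d x′∈d → Fin.suc-injective ∘ inj (there x∈d) (there x′∈d))

∣p++q∣≡∣p∣+∣q∣ : ∀ {m n} (p : Subset m) (q : Subset n) → ∣ p ++ q ∣ ≡ ∣ p ∣ + ∣ q ∣
∣p++q∣≡∣p∣+∣q∣ [] q = refl
∣p++q∣≡∣p∣+∣q∣ (true ∷ p) q = cong suc (∣p++q∣≡∣p∣+∣q∣ p q)
∣p++q∣≡∣p∣+∣q∣ (false ∷ p) q = ∣p++q∣≡∣p∣+∣q∣ p q

++-mono-⊆ : ∀ {m n} {p p′ : Subset m} {q q′ : Subset n} → p ⊆ p′ → q ⊆ q′ → p ++ q ⊆ p′ ++ q′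
++-mono-⊆ {p = []} {[]} p⊆p′ q⊆q′ x∈q = q⊆q′ x∈q
++-mono-⊆ {p = true ∷ p} {s ∷ p′} p⊆p′ q⊆q′ here with p⊆p′ here
... | here = here
++-mono-⊆ {p = s ∷ p} {s′ ∷ p′} p⊆p′ q⊆q′ (there x∈p++q) =
  there (++-mono-⊆ (drop-∷-⊆ p⊆p′) q⊆q′ x∈p++q)

++-⊆⁻ˡ : ∀ {m n} {p p′ : Subset m} {q q′ : Subset n} → p ++ q ⊆ p′ ++ q′ → p ⊆ p′
++-⊆⁻ˡ {p = true ∷ p} {s ∷ p′} p++q⊆ here with p++q⊆ here
... | here = here
++-⊆⁻ˡ {p = s ∷ p} {s′ ∷ p′} p++q⊆ (there x∈p) = there (++-⊆⁻ˡ (drop-∷-⊆ p++q⊆) x∈p)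

∈-++⁺ˡ : ∀ {m n} {p : Subset m} (q : Subset n) {x} → x ∈ p → x ↑ˡ n ∈ p ++ q
∈-++⁺ˡ q here = here
∈-++⁺ˡ q (there x∈p) = there (∈-++⁺ˡ q x∈p)

∈-++⁺ʳ : ∀ {m n} (p : Subset m) {q : Subset n} {x} → x ∈ q → m ↑ʳ x ∈ p ++ q
∈-++⁺ʳ [] x∈q = x∈q
∈-++⁺ʳ (s ∷ p) x∈q = there (∈-++⁺ʳ p x∈q)

vertex-cases : ∀ m {n} (v : Fin (m + n)) → (∃ λ x → v ≡ x ↑ˡ n) ⊎ (∃ λ u → v ≡ m ↑ʳ u)
vertex-cases m {n} v with Data.Fin.splitAt m v | Fin.join-splitAt m n v
... | inj₁ x | v≡ = inj₁ (x , sym v≡)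
... | inj₂ u | v≡ = inj₂ (u , sym v≡)

-- A proper colouring of J(m,j), given as a map on all subsets of Fin m (only its values on
-- j-sets matter); total maps make the hypergraph below directly computable.
Proper : ∀ {m d} (j : ℕ) → (Subset m → Fin d) → Set
Proper {m} j c = ∀ A B → JohnsonAdj m j A B → c A ≢ c B

Occurs : ∀ {m d} (j : ℕ) → (Subset m → Fin d) → Fin d → Set
Occurs {m} j c u = ∃ λ A → ∣ A ∣ ≡ j × c A ≡ u

GoodColouring : (m j d : ℕ) → Set
GoodColouring m j d = Σ (Subset m → Fin d) λ c → Proper j c × (∀ u → Occurs j c u)

-- A colouring of the j-sets extends to all subsets (j ≤ m guarantees a default colour).
extend-to-all-subsets : ∀ {m j d} → j ≤ m → JohnsonColorable m j d → Σ (Subset m → Fin d) (Proper j)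
extend-to-all-subsets {m} {j} {d} j≤m (f , f-proper) = c , c-proper
  where
  default : Fin d
  default with choose ⊤ j (subst (j ≤_) (sym (∣⊤∣≡n m)) j≤m)
  ... | W , _ , ∣W∣≡j = f W ∣W∣≡j
  c : Subset m → Fin d
  c A with ∣ A ∣ ≟ j
  ... | yes ∣A∣≡j = f A ∣A∣≡j
  ... | no _ = default
  c-agrees : ∀ A (∣A∣≡j : ∣ A ∣ ≡ j) → c A ≡ f A ∣A∣≡j
  c-agrees A ∣A∣≡j with ∣ A ∣ ≟ j
  ... | yes p = cong (f A) (≡-irrelevant p ∣A∣≡j)
  ... | no ¬p = contradiction ∣A∣≡j ¬p
  c-proper : Proper j c
  c-proper A B adj@(∣A∣≡j , ∣B∣≡j , _) cA≡cB =
    f-proper A B adj (trans (sym (c-agrees A ∣A∣≡j)) (trans cA≡cB (c-agrees B ∣B∣≡j)))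

delete-colour : ∀ {m j d} (c : Subset m → Fin (suc d)) → Proper j c →
  (u : Fin (suc d)) → ¬ Occurs j c u → JohnsonColorable m j d
delete-colour c c-proper u u-absent =
  (λ A ∣A∣≡j → punchOut (u≢c A ∣A∣≡j)) ,
  λ A B adj@(∣A∣≡j , ∣B∣≡j , _) →
    c-proper A B adj ∘ Fin.punchOut-injective (u≢c A ∣A∣≡j) (u≢c B ∣B∣≡j)
  where
  u≢c : ∀ A → ∣ A ∣ ≡ _ → u ≢ c A
  u≢c A ∣A∣≡j u≡cA = u-absent (A , ∣A∣≡j , sym u≡cA)

-- In an optimal colouring every colour occurs, since otherwise it could be deleted.
optimal⇒all-occur : ∀ {m j χ} → ((d : ℕ) → JohnsonColorable m j d → χ ≤ d) →
  (c : Subset m → Fin χ) → Proper j c → ∀ u → Occurs j c u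
optimal⇒all-occur {χ = suc d} minimal c c-proper u
  with anySubset? (λ A → (∣ A ∣ ≟ _) ×-dec (c A Fin.≟ u))
... | yes occurs = occurs
... | no absent = contradiction (minimal d (delete-colour c c-proper u absent)) (<-irrefl refl)

chromatic⇒good : ∀ {m j χ} → j ≤ m → IsJohnsonChromaticNumber m j χ → GoodColouring m j χ
chromatic⇒good j≤m (colourable , minimal) with extend-to-all-subsets j≤m colourable
... | c , c-proper = c , c-proper , optimal⇒all-occur minimal c c-proper

paint : ∀ {m d} → (Subset m → Fin d) → Subset m → Subset m → Fin (suc d)
paint {d = d} c A T with T ≟ₛ A
... | yes _ = fromℕ d
... | no _ = inject₁ (c T)

paint-A : ∀ {m d} (c : Subset m → Fin d) {A T} → T ≡ A → paint c A T ≡ fromℕ d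
paint-A c {A} {T} T≡A with T ≟ₛ A
... | yes _ = refl
... | no T≢A = contradiction T≡A T≢A

paint-other : ∀ {m d} (c : Subset m → Fin d) {A T} → T ≢ A → paint c A T ≡ inject₁ (c T)
paint-other c {A} {T} T≢A with T ≟ₛ A
... | yes T≡A = contradiction T≡A T≢A
... | no _ = refl

-- While d < m C j, two j-sets share a colour; giving one of them a fresh colour keeps the
-- colouring good.
recolour : ∀ {m j d} → d < m C j → GoodColouring m j d → GoodColouring m j (suc d)
recolour {m} {j} {d} d<mCj (c , c-proper , c-onto) with collision c d<mCj
... | A , B , ∣A∣≡j , ∣B∣≡j , A≢B , cA≡cB = paint c A , proper , onto
  where
  proper : Proper j (paint c A)
  proper X Y adj = by-cases (X ≟ₛ A) (Y ≟ₛ A)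
    where
    by-cases : Dec (X ≡ A) → Dec (Y ≡ A) → paint c A X ≢ paint c A Y
    by-cases (yes X≡A) (yes Y≡A) _ = c-proper X Y adj (cong c (trans X≡A (sym Y≡A)))
    by-cases (yes X≡A) (no Y≢A) eq =
      Fin.fromℕ≢inject₁ (trans (sym (paint-A c X≡A)) (trans eq (paint-other c Y≢A)))
    by-cases (no X≢A) (yes Y≡A) eq =
      Fin.fromℕ≢inject₁ (trans (sym (paint-A c Y≡A)) (trans (sym eq) (paint-other c X≢A)))
    by-cases (no X≢A) (no Y≢A) eq =
      c-proper X Y adj
        (Fin.inject₁-injective (trans (sym (paint-other c X≢A)) (trans eq (paint-other c Y≢A))))
  onto : ∀ u → Occurs j (paint c A) u
  onto u with Top.view u
  ... | ‵fromℕ = A , ∣A∣≡j , paint-A c {A} refl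
  ... | ‵inject₁ u′ with c-onto u′
  ...   | T , ∣T∣≡j , cT≡u′ with T ≟ₛ A
  ...     | no T≢A = T , ∣T∣≡j , trans (paint-other c T≢A) (cong inject₁ cT≡u′)
  ...     | yes T≡A = B , ∣B∣≡j , trans (paint-other c (A≢B ∘ sym))
                        (cong inject₁ (trans (sym cA≡cB) (trans (cong c (sym T≡A)) cT≡u′)))

enlarge : ∀ {m j d e} → d ≤ e → e ≤ m C j → GoodColouring m j d → GoodColouring m j e
enlarge d≤e = go (≤⇒≤′ d≤e)
  where
  go : ∀ {m j d e} → d ≤′ e → e ≤ m C j → GoodColouring m j d → GoodColouring m j e
  go (≤′-reflexive refl) _ good = good
  go (≤′-step d≤e) e<mCj good = recolour e<mCj (go d≤e (<⇒≤ e<mCj) good)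

module Construction {m y i : ℕ} (colouring : GoodColouring m (suc i) y) where

  j k r : ℕ
  j = suc i
  k = suc j
  r = y + j

  c : Subset m → Fin y
  c = proj₁ colouring

  c-proper : Proper j c
  c-proper = proj₁ (proj₂ colouring)

  c-onto : ∀ u → Occurs j c u
  c-onto = proj₂ (proj₂ colouring)

  cap : Subset m → Subset (m + y)
  cap T = T ++ ⁅ c T ⁆

  ∣cap∣ : ∀ T → ∣ T ∣ ≡ j → ∣ cap T ∣ ≡ k
  ∣cap∣ T ∣T∣≡j =
    trans (∣p++q∣≡∣p∣+∣q∣ T ⁅ c T ⁆) (trans (cong₂ _+_ ∣T∣≡j (∣⁅x⁆∣≡1 (c T))) (+-comm j 1))

  IsCap : Subset (m + y) → Set
  IsCap S = ∃ λ T → ∣ T ∣ ≡ j × S ≡ cap T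

  isCap? : ∀ S → Dec (IsCap S)
  isCap? S with splitAt m S
  ... | A , B , refl = map′ to from ((∣ A ∣ ≟ j) ×-dec (B ≟ₛ ⁅ c A ⁆))
    where
    to : ∣ A ∣ ≡ j × B ≡ ⁅ c A ⁆ → IsCap (A ++ B)
    to (∣A∣≡j , B≡) = A , ∣A∣≡j , cong (A ++_) B≡
    from : IsCap (A ++ B) → ∣ A ∣ ≡ j × B ≡ ⁅ c A ⁆
    from (T , ∣T∣≡j , eq) with Vec.++-injective A T eq
    ... | refl , B≡ = ∣T∣≡j , B≡

  IsHEdge : Subset (m + y) → Set
  IsHEdge S = ∣ S ∣ ≡ k × ¬ IsCap S

  isHEdge? : ∀ S → Dec (IsHEdge S)
  isHEdge? S = (∣ S ∣ ≟ k) ×-dec ¬? (isCap? S)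

  H : Hypergraph (m + y)
  H S = does (isHEdge? S)

  edge⇒ : ∀ {S} → IsEdge H S → IsHEdge S
  edge⇒ {S} = does⇒witness (isHEdge? S)
    where
    does⇒witness : ∀ {A : Set} (a? : Dec A) → does a? ≡ true → A
    does⇒witness (yes a) _ = a
    does⇒witness (no _) ()

  ⇒edge : ∀ {S} → IsHEdge S → IsEdge H S
  ⇒edge {S} = dec-true (isHEdge? S)

  cap-not-edge : ∀ T → ∣ T ∣ ≡ j → ¬ IsEdge H (cap T)
  cap-not-edge T ∣T∣≡j S∈H = proj₂ (edge⇒ S∈H) (T , ∣T∣≡j , refl)

  non-edge⇒cap : ∀ {S} → ∣ S ∣ ≡ k → ¬ IsEdge H S → IsCap S
  non-edge⇒cap {S} ∣S∣≡k S∉H =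
    decidable-stable (isCap? S) (λ ¬isCap → S∉H (⇒edge (∣S∣≡k , ¬isCap)))

  uniform : IsUniform k H
  uniform S S∈H = proj₁ (edge⇒ S∈H)

  ∣W∪x∣ : ∀ {W : Subset m} {x} → ∣ W ∣ ≡ i → x ∉ W → ∣ W ∪ ⁅ x ⁆ ∣ ≡ j
  ∣W∪x∣ {W} {x} ∣W∣≡i x∉W = trans (∣p∪⁅x⁆∣≡1+∣p∣ W x x∉W) (cong suc ∣W∣≡i)

  -- For ∣W∣ = i the j-sets W ∪ {x}, W ∪ {x′} are adjacent in J(m,j) unless x = x′,
  -- so the colouring separates them.
  colour-injective : ∀ {W : Subset m} {x x′} → ∣ W ∣ ≡ i → x ∉ W → x′ ∉ W →
    c (W ∪ ⁅ x ⁆) ≡ c (W ∪ ⁅ x′ ⁆) → x ≡ x′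
  colour-injective {W} {x} {x′} ∣W∣≡i x∉W x′∉W same with x Fin.≟ x′
  ... | yes x≡x′ = x≡x′
  ... | no x≢x′ = contradiction same
    (c-proper (W ∪ ⁅ x ⁆) (W ∪ ⁅ x′ ⁆) (∣W∪x∣ ∣W∣≡i x∉W , ∣W∪x∣ ∣W∣≡i x′∉W , meet))
    where
    meet : ∣ (W ∪ ⁅ x ⁆) ∩ (W ∪ ⁅ x′ ⁆) ∣ ≡ i
    meet = trans (cong ∣_∣ (∪⁅⁆∩∪⁅⁆≡ W x≢x′)) ∣W∣≡i

  -- The counting step: if the colours of W ∪ {x}, x ∈ A ∖ W, all avoid B, then
  -- ∣A∣ + ∣B∣ ≤ y + i, because these colours are distinct and lie in the complement of B.
  colour-count : ∀ (A : Subset m) (B : Subset y) {W} → ∣ W ∣ ≡ i → W ⊆ A →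
    (∀ {x} → x ∈ A → x ∉ W → c (W ∪ ⁅ x ⁆) ∉ B) → ∣ A ∣ + ∣ B ∣ ≤ y + i
  colour-count A B {W} ∣W∣≡i W⊆A avoids = begin
    ∣ A ∣ + ∣ B ∣             ≡⟨ cong (_+ ∣ B ∣) (sym (∣p─q∣+∣q∣≡∣p∣ A W W⊆A)) ⟩
    ∣ A ─ W ∣ + ∣ W ∣ + ∣ B ∣ ≡⟨ cong (λ w → ∣ A ─ W ∣ + w + ∣ B ∣) ∣W∣≡i ⟩
    ∣ A ─ W ∣ + i + ∣ B ∣     ≡⟨ xy∙z≈xz∙y (∣ A ─ W ∣) i (∣ B ∣) ⟩
    ∣ A ─ W ∣ + ∣ B ∣ + i     ≤⟨ +-monoˡ-≤ i (+-monoˡ-≤ (∣ B ∣) outside-B) ⟩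
    ∣ ∁ B ∣ + ∣ B ∣ + i       ≡⟨ cong (λ b → b + ∣ B ∣ + i) (∣∁p∣≡n∸∣p∣ B) ⟩
    y ∸ ∣ B ∣ + ∣ B ∣ + i     ≡⟨ cong (_+ i) (m∸n+n≡m (∣p∣≤n B)) ⟩
    y + i                     ∎
    where
    open ≤-Reasoning
    ∉W : ∀ {x} → x ∈ A ─ W → x ∉ W
    ∉W = x∈p─q⇒x∉q {p = A}
    outside-B : ∣ A ─ W ∣ ≤ ∣ ∁ B ∣
    outside-B = injection⇒∣∣≤ (A ─ W) (∁ B) (λ x → c (W ∪ ⁅ x ⁆))
      (λ x∈A─W → x∉p⇒x∈∁p (avoids (p─q⊆p A W x∈A─W) (∉W x∈A─W)))
      (λ x∈A─W x′∈A─W → colour-injective ∣W∣≡i (∉W x∈A─W) (∉W x′∈A─W))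

  first-block-large : ∀ (A : Subset m) (B : Subset y) → ∣ A ++ B ∣ ≡ r → j ≤ ∣ A ∣
  first-block-large A B ∣R∣≡r = +-cancelˡ-≤ y j ∣ A ∣ (begin
    y + j         ≡⟨ trans (sym ∣R∣≡r) (∣p++q∣≡∣p∣+∣q∣ A B) ⟩
    ∣ A ∣ + ∣ B ∣ ≤⟨ +-monoʳ-≤ ∣ A ∣ (∣p∣≤n B) ⟩
    ∣ A ∣ + y     ≡⟨ +-comm ∣ A ∣ y ⟩
    y + ∣ A ∣     ∎)
    where open ≤-Reasoning

  -- The clique must then avoid all colours
  -- c (W ∪ {x}) in B, and the counting step makes it too small.
  no-clique-over : ∀ (E : Subset (m + y) → Set) (A : Subset m) (B : Subset y) {W} →
    ∣ W ∣ ≡ i → W ⊆ A → (∀ {x} → x ∈ A → x ∉ W → ¬ E (cap (W ∪ ⁅ x ⁆))) →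
    ¬ IsCliqueOn k r E (A ++ B)
  no-clique-over E A B {W} ∣W∣≡i W⊆A caps-missing (∣R∣≡r , clique) =
    <-irrefl refl (+-cancelˡ-≤ y (suc i) i
      (subst (_≤ y + i) ∣A∣+∣B∣≡r (colour-count A B ∣W∣≡i W⊆A avoids)))
    where
    ∣A∣+∣B∣≡r : ∣ A ∣ + ∣ B ∣ ≡ r
    ∣A∣+∣B∣≡r = trans (sym (∣p++q∣≡∣p∣+∣q∣ A B)) ∣R∣≡r
    avoids : ∀ {x} → x ∈ A → x ∉ W → c (W ∪ ⁅ x ⁆) ∉ B
    avoids x∈A x∉W c∈B = caps-missing x∈A x∉W
      (clique _ (++-mono-⊆ (∪⁅⁆-⊆ W⊆A x∈A) (x∈p⇒⁅x⁆⊆p c∈B))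
                (∣cap∣ (W ∪ ⁅ _ ⁆) (∣W∪x∣ ∣W∣≡i x∉W)))

  -- H has no K_r: take for W any i-subset of the first-block part of a would-be clique.
  clique-free : ¬ Σ (Subset (m + y)) (IsCliqueOn k r (IsEdge H))
  clique-free (R , clique) with splitAt m R
  ... | A , B , refl with choose A i (≤-trans (n≤1+n i) (first-block-large A B (proj₁ clique)))
  ... | W , W⊆A , ∣W∣≡i =
    no-clique-over (IsEdge H) A B ∣W∣≡i W⊆A
      (λ _ x∉W → cap-not-edge (W ∪ ⁅ _ ⁆) (∣W∪x∣ ∣W∣≡i x∉W)) clique

  completion : ∀ {T} → ∣ T ∣ ≡ j → IsCliqueOn k r (AddEdge H (cap T)) (T ++ ⊤)
  completion {T} ∣T∣≡j = size , clique
    where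
    size : ∣ T ++ ⊤ ∣ ≡ r
    size = trans (∣p++q∣≡∣p∣+∣q∣ T ⊤) (trans (cong₂ _+_ ∣T∣≡j (∣⊤∣≡n y)) (+-comm j y))
    clique : ∀ S → S ⊆ T ++ ⊤ → ∣ S ∣ ≡ k → AddEdge H (cap T) S
    clique S S⊆T++⊤ ∣S∣≡k = by-cases S S⊆T++⊤ ∣S∣≡k (isCap? S)
      where
      by-cases : ∀ S → S ⊆ T ++ ⊤ → ∣ S ∣ ≡ k → Dec (IsCap S) → AddEdge H (cap T) S
      by-cases S _ ∣S∣≡k (no ¬cap) = inj₁ (⇒edge (∣S∣≡k , ¬cap))
      by-cases S S⊆T++⊤ _ (yes (T′ , ∣T′∣≡j , refl)) =
        inj₂ (cong cap (⊆∧∣≡∣⇒≡ (++-⊆⁻ˡ S⊆T++⊤) (trans ∣T′∣≡j (sym ∣T∣≡j))))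

  small-block-clique : ∀ {T} → ∣ T ∣ ≡ j → ∀ A B → ∣ A ∣ ≡ j →
    IsCliqueOn k r (AddEdge H (cap T)) (A ++ B) → A ++ B ≡ T ++ ⊤
  small-block-clique {T} ∣T∣≡j A B ∣A∣≡j (∣R∣≡r , clique) = cong₂ _++_ A≡T B≡⊤
    where
    B≡⊤ : B ≡ ⊤
    B≡⊤ = ∣p∣≡n⇒p≡⊤ (+-cancelˡ-≡ j ∣ B ∣ y (begin
      j + ∣ B ∣     ≡⟨ cong (_+ ∣ B ∣) (sym ∣A∣≡j) ⟩
      ∣ A ∣ + ∣ B ∣ ≡⟨ trans (sym (∣p++q∣≡∣p∣+∣q∣ A B)) ∣R∣≡r ⟩
      y + j         ≡⟨ +-comm y j ⟩
      j + y         ∎))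
      where open ≡-Reasoning
    ⁅cA⁆⊆B : ⁅ c A ⁆ ⊆ B
    ⁅cA⁆⊆B {x} _ = subst (x ∈_) (sym B≡⊤) ∈⊤
    A≡T : A ≡ T
    A≡T with clique (cap A) (++-mono-⊆ (λ x∈A → x∈A) ⁅cA⁆⊆B) (∣cap∣ A ∣A∣≡j)
    ... | inj₁ cap-A∈H = contradiction cap-A∈H (cap-not-edge A ∣A∣≡j)
    ... | inj₂ cap-A≡cap-T = Vec.++-injectiveˡ A T cap-A≡cap-T

  -- An r-clique of H + cap T cannot meet the first block in more than j vertices: it then
  -- has a vertex z ∉ T, and an i-set W ∋ z makes every cap over W ∪ {x} a non-edge ≠ cap T.
  large-block-clique : 1 ≤ i → ∀ {T} → ∣ T ∣ ≡ j → ∀ A B → j < ∣ A ∣ →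
    ¬ IsCliqueOn k r (AddEdge H (cap T)) (A ++ B)
  large-block-clique 1≤i {T} ∣T∣≡j A B j<∣A∣ clique
    with ∣q∣<∣p∣⇒outside {p = A} {q = T} (subst (_< ∣ A ∣) (sym ∣T∣≡j) j<∣A∣)
  ... | z , z∈A , z∉T with choose∋ A i z∈A 1≤i (≤-trans (n≤1+n i) (<⇒≤ j<∣A∣))
  ... | W , W⊆A , ∣W∣≡i , z∈W =
    no-clique-over (AddEdge H (cap T)) A B ∣W∣≡i W⊆A not-added clique
    where
    not-added : ∀ {x} → x ∈ A → x ∉ W → ¬ AddEdge H (cap T) (cap (W ∪ ⁅ x ⁆))
    not-added {x} _ x∉W (inj₁ cap∈H) = cap-not-edge (W ∪ ⁅ x ⁆) (∣W∪x∣ ∣W∣≡i x∉W) cap∈H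
    not-added {x} _ _ (inj₂ same-cap) =
      z∉T (subst (z ∈_) (Vec.++-injectiveˡ (W ∪ ⁅ x ⁆) T same-cap) (x∈p∪q⁺ (inj₁ z∈W)))

  completion-unique : 1 ≤ i → ∀ {T} → ∣ T ∣ ≡ j →
    ∀ R → IsCliqueOn k r (AddEdge H (cap T)) R → R ≡ T ++ ⊤
  completion-unique 1≤i ∣T∣≡j R clique with splitAt m R
  ... | A , B , refl with m≤n⇒m<n∨m≡n (first-block-large A B (proj₁ clique))
  ... | inj₁ j<∣A∣ = contradiction clique (large-block-clique 1≤i ∣T∣≡j A B j<∣A∣)
  ... | inj₂ j≡∣A∣ = small-block-clique ∣T∣≡j A B (sym j≡∣A∣) clique

  -- Every vertex lies on some cap: a first-block vertex x on the cap over any j-set ∋ x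
  -- (here j ≤ m is needed), a colour u on the cap over a j-set coloured u.
  on-some-cap : j ≤ m → ∀ v → ∃ λ T → ∣ T ∣ ≡ j × v ∈ cap T
  on-some-cap j≤m v with vertex-cases m v
  ... | inj₁ (x , refl) = first-block x
    where
    first-block : ∀ x → ∃ λ T → ∣ T ∣ ≡ j × x ↑ˡ y ∈ cap T
    first-block x with choose∋ ⊤ j ∈⊤ (s≤s z≤n) (subst (j ≤_) (sym (∣⊤∣≡n m)) j≤m)
    ... | T , _ , ∣T∣≡j , x∈T = T , ∣T∣≡j , ∈-++⁺ˡ ⁅ c T ⁆ x∈T
  ... | inj₂ (u , refl) = second-block u
    where
    second-block : ∀ u → ∃ λ T → ∣ T ∣ ≡ j × m ↑ʳ u ∈ cap T
    second-block u with c-onto u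
    ... | T , ∣T∣≡j , cT≡u =
      T , ∣T∣≡j , ∈-++⁺ʳ T (subst (λ w → u ∈ ⁅ w ⁆) (sym cT≡u) (x∈⁅x⁆ u))

  no-dominating : j ≤ m → ∀ v → ¬ IsDominating k H v
  no-dominating j≤m v dominating with on-some-cap j≤m v
  ... | T , ∣T∣≡j , v∈cap = cap-not-edge T ∣T∣≡j (dominating (cap T) (∣cap∣ T ∣T∣≡j) v∈cap)

  saturated-hypergraph : 1 ≤ i → j ≤ m →
    Σ (Hypergraph (m + y)) λ G → IsUniform k G × IsPrimitiveUniquelySaturated k r G
  saturated-hypergraph 1≤i j≤m = H , uniform , (clique-free , add-cap) , no-dominating j≤m
    where
    add-cap : ∀ S → ∣ S ∣ ≡ k → ¬ IsEdge H S →
      Σ (Subset (m + y)) λ R → IsCliqueOn k r (AddEdge H S) R ×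
        (∀ R′ → IsCliqueOn k r (AddEdge H S) R′ → R′ ≡ R)
    add-cap S ∣S∣≡k S∉H with non-edge⇒cap ∣S∣≡k S∉H
    ... | T , ∣T∣≡j , refl = T ++ ⊤ , completion ∣T∣≡j , completion-unique 1≤i ∣T∣≡j

block-sizes : ∀ {j r n} → j ≤ r → r ≤ n → n ∸ r + j + (r ∸ j) ≡ n
block-sizes {j} {r} {n} j≤r r≤n = begin
  n ∸ r + j + (r ∸ j)   ≡⟨ +-assoc (n ∸ r) j (r ∸ j) ⟩
  n ∸ r + (j + (r ∸ j)) ≡⟨ cong (n ∸ r +_) (m+[n∸m]≡n j≤r) ⟩
  n ∸ r + r             ≡⟨ m∸n+n≡m r≤n ⟩
  n                     ∎
  where open ≡-Reasoning

theorem7 : (k r n χ : ℕ) → 3 ≤ k → k < r → r < n →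
    IsJohnsonChromaticNumber (n ∸ r + k ∸ 1) (k ∸ 1) χ →
    χ + (n ∸ r + k ∸ 1) ≤ n →
    n ≤ ((n ∸ r + k ∸ 1) C (k ∸ 1)) + (n ∸ r + k ∸ 1) →
    Σ (Hypergraph n) λ H → IsUniform k H × IsPrimitiveUniquelySaturated k r H
theorem7 (suc (suc (suc h))) r n χ (s≤s (s≤s (s≤s z≤n))) k<r r<n chromatic χ+m≤n n≤mCj+m =
  subst₂ (λ N R → Σ (Hypergraph N) λ H → IsUniform k H × IsPrimitiveUniquelySaturated k R H)
    m+y≡n y+j≡r (Construction.saturated-hypergraph colouring (s≤s z≤n) j≤m)
  where
  k j m y : ℕ
  k = suc (suc (suc h))
  j = k ∸ 1
  m = n ∸ r + k ∸ 1
  y = r ∸ j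
  j≤r : j ≤ r
  j≤r = ≤-trans (n≤1+n j) (<⇒≤ k<r)
  m≡ : m ≡ n ∸ r + j
  m≡ = cong (_∸ 1) (+-suc (n ∸ r) j)
  y+j≡r : y + j ≡ r
  y+j≡r = m∸n+n≡m j≤r
  m+y≡n : m + y ≡ n
  m+y≡n = trans (cong (_+ y) m≡) (block-sizes j≤r (<⇒≤ r<n))
  j≤m : j ≤ m
  j≤m = subst (j ≤_) (sym m≡) (m≤n+m j (n ∸ r))
  χ≤y : χ ≤ y
  χ≤y = +-cancelʳ-≤ m χ y (subst (χ + m ≤_) (trans (sym m+y≡n) (+-comm m y)) χ+m≤n)
  y≤mCj : y ≤ m C j
  y≤mCj = +-cancelʳ-≤ m y (m C j) (subst (_≤ m C j + m) (trans (sym m+y≡n) (+-comm m y)) n≤mCj+m)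
  colouring : GoodColouring m j y
  colouring = enlarge χ≤y y≤mCj (chromatic⇒good j≤m chromatic)
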